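{- Let $P_n$ be the path on $n$ vertices and $C_n$ the cycle on $n$ vertices. If $n$ is even then $t_2(P_n)=\lceil n/2\rceil+1$ and $t_2(C_n)=\lceil n/2\rceil$; if $n$ is odd then $t_2(P_n)=t_2(C_n)=\lceil n/2\rceil$.
   Context: Cycles are considered for $n\ge 3$. The 2-burning process: given a graph $G$ and a sequence $s=(s_1,\dots,s_k)$ of vertices of $G$ (sources), at round $0$ all vertices are uncolored; at each round $j\ge1$, (i) if $j\le k$ and $s_j$ is uncolored, $s_j$ is colored blue, and (ii) every uncolored vertex having at least two neighbors that were blue at the end of round $j-1$ is colored blue. $s$ is a 2-burning sequence if eventually all vertices are blue; $\mathrm{len}(s)=k$ and $\mathrm{rd}(s)$ is the first round at the end of which all vertices are blue. $b_2(G)$ is the minimum of $\mathrm{rd}(s)$ over all 2-burning sequences; a 2-burning sequence achieving it is optimal; $t_2(G)$ is the minimum length of an optimal 2-burning sequence. (It is known that $b_2(P_n)=b_2(C_n)=\lceil n/2\rceil+1$.) -}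

module Defs where

open import Data.Nat using (ℕ; zero; suc; _+_; _∸_; _≤_; _<_; _≡ᵇ_; _≤ᵇ_)
open import Data.Bool using (Bool; true; false; _∧_; _∨_; if_then_else_)
open import Data.Fin using (Fin; toℕ)
open import Data.Fin.Properties using () renaming (_≟_ to _≟F_)
open import Data.List using (List; []; _∷_; length)
open import Data.Product using (Σ; _×_; ∃)
open import Relation.Binary.PropositionalEquality using (_≡_)
open import Relation.Nullary using (¬_; does)

Graph : ℕ → Set
Graph n = Fin n → Fin n → Bool

pathAdj : (n : ℕ) → Graph n
pathAdj n u v = (suc (toℕ u) ≡ᵇ toℕ v) ∨ (suc (toℕ v) ≡ᵇ toℕ u)

-- Cycle C_n (intended for n ≥ 3): path plus the edge {0, n-1}.
cycleAdj : (n : ℕ) → Graph n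
cycleAdj n u v = pathAdj n u v
  ∨ ((toℕ u ≡ᵇ 0) ∧ (toℕ v ≡ᵇ (n ∸ 1)))
  ∨ ((toℕ v ≡ᵇ 0) ∧ (toℕ u ≡ᵇ (n ∸ 1)))

count : (n : ℕ) → (Fin n → Bool) → ℕ
count zero    p = 0
count (suc n) p = (if p Fin.zero then 1 else 0) + count n (λ i → p (Fin.suc i))
  where import Data.Fin as Fin

-- isSource s j v : j ≥ 1, j ≤ length s and s_j = v  (s_j is the j-th entry, 1-indexed)
isSource : ∀ {n} → List (Fin n) → ℕ → Fin n → Bool
isSource []      _             v = false
isSource (x ∷ s) zero          v = false
isSource (x ∷ s) (suc zero)    v = does (x ≟F v)
isSource (x ∷ s) (suc (suc j)) v = isSource s (suc j) v

-- blue G s j v : vertex v is blue at the end of round j of the 2-burning process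
blue : ∀ {n} → Graph n → List (Fin n) → ℕ → Fin n → Bool
blue G s zero    v = false
blue {n} G s (suc j) v =
  blue G s j v
  ∨ isSource s (suc j) v
  ∨ (2 ≤ᵇ count n (λ u → G v u ∧ blue G s j u))

AllBlue : ∀ {n} → Graph n → List (Fin n) → ℕ → Set
AllBlue G s j = ∀ v → blue G s j v ≡ true

HasRound : ∀ {n} → Graph n → List (Fin n) → ℕ → Set
HasRound G s r = AllBlue G s r × (∀ j → j < r → ¬ AllBlue G s j)

Optimal : ∀ {n} → Graph n → List (Fin n) → ℕ → Set
Optimal G s r = HasRound G s r × (∀ s' r' → HasRound G s' r' → r ≤ r')

T2Is : ∀ {n} → Graph n → ℕ → Set
T2Is G m =
  (Σ (List _) λ s → Σ ℕ λ r → Optimal G s r × length s ≡ m)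
  × (∀ s r → Optimal G s r → m ≤ length s)

{-# OPTIONS --safe #-}

-- For a set B of vertices of P_n or C_n let Φ(B) be the number of vertices in B
-- plus the number of maximal runs of consecutive vertices of B.  A round of
-- 2-burning raises Φ by at most 2: the new source adds a vertex and at most one
-- run, and a vertex burnt by its two neighbours fills a one-vertex hole, adding a
-- vertex but merging two runs.  Hence Φ(B_j) ≤ 2 min(j, |s|).  If all vertices
-- are blue after round j + 1, every vertex outside B_j is such a hole or the
-- single source of that round, which forces n ≤ Φ(B_j); so 2 rd(s) ≥ n + 2.
-- The all-blue set has Φ = n + 1 on P_n and Φ = n on C_n, so |s| ≥ ⌊n/2⌋ + 1
-- on P_n and |s| ≥ ⌈n/2⌉ on C_n.  Burning the vertices 0, 2, 4, … (and the
-- last vertex of P_n) attains all these bounds in round ⌈n/2⌉ + 1.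

module Submission where

open import Defs
open import Data.Nat.DivMod using (_%_)
open import Data.Nat using (ℕ; zero; suc; pred; _+_; _*_; _≤_; _<_; _≡ᵇ_; _≤ᵇ_; _⊓_; ⌊_/2⌋; ⌈_/2⌉)
open import Data.Nat using (z≤n; s≤s; z<s; s<s)
open import Data.Nat.Properties
open import Algebra.Properties.CommutativeSemigroup +-commutativeSemigroup
  using (interchange; xy∙z≈xz∙y)
open import Data.Bool using (Bool; true; false; not; _∧_; _∨_; if_then_else_; T)
open import Data.Bool.Properties
  using (T-∧; T-≡; ∧-zeroʳ; ∧-identityʳ; ∨-identityʳ; ∨-comm; ∧-distribʳ-∨)
open import Data.Empty using (⊥; ⊥-elim)
open import Data.Fin as Fin using (Fin; toℕ; fromℕ<)
open import Data.Fin.Properties using (toℕ-fromℕ<; toℕ<n) renaming (_≟_ to _≟ᶠ_)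
open import Data.Product using (Σ; _×_; _,_; proj₁; proj₂)
open import Data.Sum using (_⊎_; inj₁; inj₂)
open import Data.List using (List; []; _∷_; length; applyUpTo)
open import Data.List.Properties using (length-applyUpTo)
open import Function using (id; _∘_; Equivalence)
open import Relation.Binary.PropositionalEquality
open import Relation.Nullary using (¬_; yes; no; does)
open import Relation.Nullary.Decidable using (dec-true; dec-false)
open Equivalence using (to; from)

⟦_⟧ : Bool → ℕ
⟦ b ⟧ = if b then 1 else 0

BoolFun : ℕ → Set → Set
BoolFun zero    A = A
BoolFun (suc k) A = Bool → BoolFun k A

Pointwise≤ : ∀ k → BoolFun k ℕ → BoolFun k ℕ → Set
Pointwise≤ zero    m n = m ≤ n
Pointwise≤ (suc k) f g = ∀ x → Pointwise≤ k (f x) (g x)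

pointwise≤ᵇ : ∀ k → BoolFun k ℕ → BoolFun k ℕ → Bool
pointwise≤ᵇ zero    m n = m ≤ᵇ n
pointwise≤ᵇ (suc k) f g = pointwise≤ᵇ k (f true) (g true) ∧ pointwise≤ᵇ k (f false) (g false)

-- An inequality between two functions of k Booleans, checked on all 2^k arguments.
-- Used as `truth-table k _ _ _`: both sides are found by unification with the goal.
truth-table : ∀ k f g → T (pointwise≤ᵇ k f g) → Pointwise≤ k f g
truth-table zero    m n holds       = ≤ᵇ⇒≤ m n holds
truth-table (suc k) f g holds true  = truth-table k (f true) (g true) (proj₁ (to T-∧ holds))
truth-table (suc k) f g holds false = truth-table k (f false) (g false) (proj₂ (to T-∧ holds))

⟦∨⟧-disjoint : ∀ x y → (T x → T y → ⊥) → ⟦ x ∨ y ⟧ ≡ ⟦ x ⟧ + ⟦ y ⟧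
⟦∨⟧-disjoint true  true  disjoint = ⊥-elim (disjoint _ _)
⟦∨⟧-disjoint true  false disjoint = refl
⟦∨⟧-disjoint false y     disjoint = refl

T-∨-monoʳ : ∀ x {y z} → (T y → T z) → T (x ∨ y) → T (x ∨ z)
T-∨-monoʳ true  y⇒z x∨y = x∨y
T-∨-monoʳ false y⇒z y   = y⇒z y

T-∧-last : ∀ x y {z} → T (x ∧ y ∧ z) → T z
T-∧-last true true z = z

T-keep : ∀ b {r} → T b → T (b ∨ r)
T-keep true _ = _

T-source : ∀ b {s r} → T s → T (b ∨ s ∨ r)
T-source true          _ = _
T-source false {true}  _ = _

T-fill : ∀ b s {p q} → T p → T q → T (b ∨ s ∨ (not b ∧ p ∧ q))
T-fill true  _                    _ _ = _
T-fill false true                 _ _ = _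
T-fill false false {true} {true}  _ _ = _

≡ᵇ-refl : ∀ m → (m ≡ᵇ m) ≡ true
≡ᵇ-refl m = dec-true (m ≟ m) refl

≢⇒≡ᵇ-false : ∀ {m n} → m ≢ n → (m ≡ᵇ n) ≡ false
≢⇒≡ᵇ-false {m} {n} = dec-false (m ≟ n)

≡ᵇ-sym : ∀ m n → (m ≡ᵇ n) ≡ (n ≡ᵇ m)
≡ᵇ-sym zero    zero    = refl
≡ᵇ-sym zero    (suc n) = refl
≡ᵇ-sym (suc m) zero    = refl
≡ᵇ-sym (suc m) (suc n) = ≡ᵇ-sym m n

∑< : ℕ → (ℕ → ℕ) → ℕ
∑< zero    f = 0
∑< (suc n) f = f 0 + ∑< n (f ∘ suc)

syntax ∑< n (λ i → e) = ∑[ i < n ] e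

∑-mono-≤ : ∀ n {f g : ℕ → ℕ} → (∀ i → i < n → f i ≤ g i) → ∑< n f ≤ ∑< n g
∑-mono-≤ zero    f≤g = z≤n
∑-mono-≤ (suc n) f≤g = +-mono-≤ (f≤g 0 z<s) (∑-mono-≤ n λ i i<n → f≤g (suc i) (s<s i<n))

∑-distrib-+ : ∀ n (f g : ℕ → ℕ) → ∑[ i < n ] (f i + g i) ≡ ∑< n f + ∑< n g
∑-distrib-+ zero    f g = refl
∑-distrib-+ (suc n) f g =
  trans (cong (f 0 + g 0 +_) (∑-distrib-+ n (f ∘ suc) (g ∘ suc))) (interchange (f 0) (g 0) _ _)

∑-const : ∀ n c → ∑[ i < n ] c ≡ n * c
∑-const zero    c = refl
∑-const (suc n) c = cong (c +_) (∑-const n c)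

∑-*ˡ : ∀ n c (f : ℕ → ℕ) → ∑[ i < n ] (c * f i) ≡ c * ∑< n f
∑-*ˡ zero    c f = sym (*-zeroʳ c)
∑-*ˡ (suc n) c f = trans (cong (c * f 0 +_) (∑-*ˡ n c (f ∘ suc))) (sym (*-distribˡ-+ c (f 0) _))

∑-last : ∀ n (f : ℕ → ℕ) → ∑< (suc n) f ≡ ∑< n f + f n
∑-last zero    f = +-comm (f 0) 0
∑-last (suc n) f = trans (cong (f 0 +_) (∑-last n (f ∘ suc))) (sym (+-assoc (f 0) _ _))

n≤∑< : ∀ n {f : ℕ → ℕ} → (∀ i → i < n → 1 ≤ f i) → n ≤ ∑< n f
n≤∑< n {f} 1≤f = subst (_≤ ∑< n f) (trans (∑-const n 1) (*-identityʳ n)) (∑-mono-≤ n 1≤f)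

⌊2*n/2⌋≡n : ∀ n → ⌊ 2 * n /2⌋ ≡ n
⌊2*n/2⌋≡n n = trans (cong (λ x → ⌊ n + x /2⌋) (+-identityʳ n)) (sym (n≡⌊n+n/2⌋ n))

⌈2*n/2⌉≡n : ∀ n → ⌈ 2 * n /2⌉ ≡ n
⌈2*n/2⌉≡n n = trans (cong (λ x → ⌈ n + x /2⌉) (+-identityʳ n)) (sym (n≡⌈n+n/2⌉ n))

n≤2*r⇒⌈n/2⌉≤r : ∀ {n r} → n ≤ 2 * r → ⌈ n /2⌉ ≤ r
n≤2*r⇒⌈n/2⌉≤r {n} {r} n≤2r = subst (⌈ n /2⌉ ≤_) (⌈2*n/2⌉≡n r) (⌈n/2⌉-mono n≤2r)

2*i<n⇒i<⌈n/2⌉ : ∀ {i n} → 2 * i < n → i < ⌈ n /2⌉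
2*i<n⇒i<⌈n/2⌉ {i} {n} 2i<n = subst (_≤ ⌈ n /2⌉) (cong suc (⌊2*n/2⌋≡n i)) (⌈n/2⌉-mono 2i<n)

n≤2*⌈n/2⌉ : ∀ n → n ≤ 2 * ⌈ n /2⌉
n≤2*⌈n/2⌉ zero          = z≤n
n≤2*⌈n/2⌉ (suc zero)    = s≤s z≤n
n≤2*⌈n/2⌉ (suc (suc n)) =
  subst (suc (suc n) ≤_) (sym (*-suc 2 ⌈ n /2⌉)) (s≤s (s≤s (n≤2*⌈n/2⌉ n)))

parity : ∀ n → Σ ℕ λ p → n ≡ 2 * p ⊎ n ≡ suc (2 * p)
parity zero = 0 , inj₁ refl
parity (suc n) with parity n
... | p , inj₁ n≡2p   = p , inj₂ (cong suc n≡2p)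
... | p , inj₂ n≡1+2p = suc p , inj₁ (trans (cong suc n≡1+2p) (sym (*-suc 2 p)))

n%2≡0⇒⌊n/2⌋≡⌈n/2⌉ : ∀ n → n % 2 ≡ 0 → ⌊ n /2⌋ ≡ ⌈ n /2⌉
n%2≡0⇒⌊n/2⌋≡⌈n/2⌉ zero          _    = refl
n%2≡0⇒⌊n/2⌋≡⌈n/2⌉ (suc (suc n)) even = cong suc (n%2≡0⇒⌊n/2⌋≡⌈n/2⌉ n even)

n%2≡1⇒1+⌊n/2⌋≡⌈n/2⌉ : ∀ n → n % 2 ≡ 1 → suc ⌊ n /2⌋ ≡ ⌈ n /2⌉
n%2≡1⇒1+⌊n/2⌋≡⌈n/2⌉ (suc zero)    _   = refl
n%2≡1⇒1+⌊n/2⌋≡⌈n/2⌉ (suc (suc n)) odd = cong suc (n%2≡1⇒1+⌊n/2⌋≡⌈n/2⌉ n odd)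

extend : ∀ {n} → (Fin n → Bool) → ℕ → Bool
extend {zero}  p k       = false
extend {suc n} p zero    = p Fin.zero
extend {suc n} p (suc k) = extend (p ∘ Fin.suc) k

extend-toℕ : ∀ {n} (p : Fin n → Bool) v → extend p (toℕ v) ≡ p v
extend-toℕ p Fin.zero    = refl
extend-toℕ p (Fin.suc v) = extend-toℕ (p ∘ Fin.suc) v

extend-fromℕ< : ∀ {n} (p : Fin n → Bool) {k} (k<n : k < n) → extend p k ≡ p (fromℕ< k<n)
extend-fromℕ< p k<n =
  subst (λ k → extend p k ≡ p (fromℕ< k<n)) (toℕ-fromℕ< k<n) (extend-toℕ p (fromℕ< k<n))

Vanishes : ℕ → (ℕ → Bool) → Set
Vanishes n B = ∀ k → n ≤ k → B k ≡ false

extend-vanishes : ∀ {n} (p : Fin n → Bool) → Vanishes n (extend p)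
extend-vanishes {zero}  p k       _         = refl
extend-vanishes {suc n} p (suc k) (s≤s n≤k) = extend-vanishes (p ∘ Fin.suc) k n≤k

extend-false : ∀ {n} k → extend {n} (λ _ → false) k ≡ false
extend-false {zero}  k       = refl
extend-false {suc n} zero    = refl
extend-false {suc n} (suc k) = extend-false {n} k

extend-witness : ∀ {n} (p : Fin n → Bool) k → T (extend p k) → Σ (Fin n) λ v → toℕ v ≡ k × T (p v)
extend-witness {suc n} p zero    pk = Fin.zero , refl , pk
extend-witness {suc n} p (suc k) pk with extend-witness (p ∘ Fin.suc) k pk
... | v , refl , pv = Fin.suc v , refl , pv

∑-extend : ∀ {n} (p : Fin n → Bool) → ∑[ k < n ] ⟦ extend p k ⟧ ≡ count n p
∑-extend {zero}  p = refl
∑-extend {suc n} p = cong (⟦ p Fin.zero ⟧ +_) (∑-extend (p ∘ Fin.suc))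

count-cong : ∀ {n} {p q : Fin n → Bool} → (∀ u → p u ≡ q u) → count n p ≡ count n q
count-cong {zero}  p≗q = refl
count-cong {suc n} p≗q = cong₂ _+_ (cong ⟦_⟧ (p≗q Fin.zero)) (count-cong (p≗q ∘ Fin.suc))

count-false : ∀ n → count n (λ _ → false) ≡ 0
count-false zero    = refl
count-false (suc n) = count-false n

count-point : ∀ {n} a (C : Fin n → Bool) →
  count n (λ u → (toℕ u ≡ᵇ a) ∧ C u) ≡ ⟦ extend C a ⟧
count-point {zero}  a       C = refl
count-point {suc n} zero    C = trans (cong (⟦ C Fin.zero ⟧ +_) (count-false n)) (+-identityʳ _)
count-point {suc n} (suc a) C = count-point a (C ∘ Fin.suc)

count-∨ : ∀ {n} (p q : Fin n → Bool) → (∀ u → T (p u) → T (q u) → ⊥) →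
  count n (λ u → p u ∨ q u) ≡ count n p + count n q
count-∨ {zero}  p q disjoint = refl
count-∨ {suc n} p q disjoint =
  trans (cong₂ _+_ (⟦∨⟧-disjoint _ _ (disjoint Fin.zero))
                   (count-∨ (p ∘ Fin.suc) (q ∘ Fin.suc) (disjoint ∘ Fin.suc)))
        (interchange ⟦ p Fin.zero ⟧ ⟦ q Fin.zero ⟧ _ _)

count-pair : ∀ {n a b} (C : Fin n → Bool) → a ≢ b →
  count n (λ u → ((toℕ u ≡ᵇ a) ∨ (toℕ u ≡ᵇ b)) ∧ C u)
    ≡ ⟦ extend C a ⟧ + ⟦ extend C b ⟧
count-pair {n} {a} {b} C a≢b = begin
  count n (λ u → ((toℕ u ≡ᵇ a) ∨ (toℕ u ≡ᵇ b)) ∧ C u)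
    ≡⟨ count-cong (λ u → ∧-distribʳ-∨ (C u) (toℕ u ≡ᵇ a) (toℕ u ≡ᵇ b)) ⟩
  count n (λ u → ((toℕ u ≡ᵇ a) ∧ C u) ∨ ((toℕ u ≡ᵇ b) ∧ C u))
    ≡⟨ count-∨ _ _ disjoint ⟩
  count n (λ u → (toℕ u ≡ᵇ a) ∧ C u) + count n (λ u → (toℕ u ≡ᵇ b) ∧ C u)
    ≡⟨ cong₂ _+_ (count-point a C) (count-point b C) ⟩
  ⟦ extend C a ⟧ + ⟦ extend C b ⟧ ∎
  where
  open ≡-Reasoning
  index : ∀ {u c} → T ((toℕ u ≡ᵇ c) ∧ C u) → toℕ u ≡ c
  index {u} {c} hit = ≡ᵇ⇒≡ (toℕ u) c (proj₁ (to T-∧ hit))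
  disjoint : ∀ u → T ((toℕ u ≡ᵇ a) ∧ C u) → T ((toℕ u ≡ᵇ b) ∧ C u) → ⊥
  disjoint u at-a at-b = a≢b (trans (sym (index at-a)) (index at-b))

-- States on a path or cycle and their potential

State : Set
State = ℕ → Bool

data Shape : Set where
  path cycle : Shape

-- The vertices are 0, …, n − 1.  On the path vertex 0 has no predecessor, and the
-- successor of the last vertex is n, where the states of interest vanish.
prev : Shape → ℕ → State → State
prev _     n B (suc i) = B i
prev path  n B zero    = false
prev cycle n B zero    = B (pred n)

next : Shape → ℕ → State → State
next path  n B i = B (suc i)
next cycle n B i = if suc i ≡ᵇ n then B 0 else B (suc i)

module _ (sh : Shape) (n : ℕ) where

  hole : State → State
  hole B i = not (B i) ∧ prev sh n B i ∧ next sh n B i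

  -- The potential counts the blue vertices plus the maximal blue runs, each run at
  -- its first vertex.
  weight : State → ℕ → ℕ
  weight B i = ⟦ B i ⟧ + ⟦ B i ∧ not (prev sh n B i) ⟧

  potential : State → ℕ
  potential B = ∑[ i < n ] weight B i

  Steps : State → State → State → Set
  Steps B σ B′ = ∀ i → i < n → B′ i ≡ B i ∨ σ i ∨ hole B i

  Covered : State → State → Set
  Covered B σ = ∀ i → i < n → T (B i ∨ σ i ∨ hole B i)

next-inner : ∀ sh n (B : State) {i} → suc i < n → next sh n B i ≡ B (suc i)
next-inner path  n B 1+i<n = refl
next-inner cycle n B 1+i<n rewrite ≢⇒≡ᵇ-false (<⇒≢ 1+i<n) = refl

next-last : ∀ m (B : State) → next cycle (suc m) B m ≡ B 0
next-last m B rewrite ≡ᵇ-refl m = refl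

prev-hole : ∀ sh n B {i} → i < n →
  prev sh n (hole sh n B) i ≡ not (prev sh n B i) ∧ prev sh n (prev sh n B) i ∧ B i
prev-hole sh    n       B {suc i} i<n = cong (λ x → not (B i) ∧ prev sh n B i ∧ x) (next-inner sh n B i<n)
prev-hole path  n       B {zero}  _   = refl
prev-hole cycle (suc m) B {zero}  _   = cong (λ x → not (B m) ∧ prev cycle (suc m) B m ∧ x) (next-last m B)

prev-steps : ∀ sh n {B σ B′} → Steps sh n B σ B′ → ∀ i → i < n →
  prev sh n B′ i ≡ prev sh n B i ∨ prev sh n σ i
                    ∨ (not (prev sh n B i) ∧ prev sh n (prev sh n B) i ∧ B i)
prev-steps sh    n       {B} {σ} steps (suc i) i<n =
  trans (steps i (<⇒≤ i<n)) (cong (λ x → B i ∨ σ i ∨ x) (prev-hole sh n B i<n))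
prev-steps path  n       steps zero _ = refl
prev-steps cycle (suc m) {B} {σ} steps zero 0<n =
  trans (steps m ≤-refl) (cong (λ x → B m ∨ σ m ∨ x) (prev-hole cycle (suc m) B 0<n))

module _ {sh n B σ B′} (steps : Steps sh n B σ B′) {i} (i<n : i < n) where

  steps-keep : T (B i) → T (B′ i)
  steps-keep Bi = subst T (sym (steps i i<n)) (T-keep (B i) Bi)

  steps-source : T (σ i) → T (B′ i)
  steps-source σi = subst T (sym (steps i i<n)) (T-source (B i) σi)

  steps-fill : T (prev sh n B i) → T (next sh n B i) → T (B′ i)
  steps-fill before after = subst T (sym (steps i i<n)) (T-fill (B i) (σ i) before after)

∑-prev-cycle : ∀ n (f : State) → ∑[ i < n ] ⟦ prev cycle n f i ⟧ ≡ ∑[ i < n ] ⟦ f i ⟧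
∑-prev-cycle zero    f = refl
∑-prev-cycle (suc m) f = trans (+-comm ⟦ f m ⟧ _) (sym (∑-last m (⟦_⟧ ∘ f)))

∑-prev-hole : ∀ sh n B → Vanishes n B →
  ∑[ i < n ] ⟦ prev sh n (hole sh n B) i ⟧ ≡ ∑[ i < n ] ⟦ hole sh n B i ⟧
∑-prev-hole cycle n       B _      = ∑-prev-cycle n (hole cycle n B)
∑-prev-hole path  zero    B _      = refl
∑-prev-hole path  (suc m) B vanish = begin
  ∑[ i < m ] ⟦ g i ⟧              ≡⟨ +-identityʳ _ ⟨
  ∑[ i < m ] ⟦ g i ⟧ + 0          ≡⟨ cong (λ x → ∑[ i < m ] ⟦ g i ⟧ + ⟦ x ⟧) last-hole ⟨
  ∑[ i < m ] ⟦ g i ⟧ + ⟦ g m ⟧    ≡⟨ ∑-last m (⟦_⟧ ∘ g) ⟨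
  ∑[ i < suc m ] ⟦ g i ⟧          ∎
  where
  open ≡-Reasoning
  g : State
  g = hole path (suc m) B
  last-hole : g m ≡ false
  last-hole rewrite vanish (suc m) ≤-refl | ∧-zeroʳ (prev path (suc m) B m) = ∧-zeroʳ (not (B m))

-- a, b, c, d say whether the vertices i, i − 1, i + 1, i − 2 are blue, s and s⁻ whether
-- i and i − 1 are the source of the round; a′ and b′ are i and i − 1 after the round.
local-step : ∀ a b c d s s⁻ →
  let a′ = a ∨ s ∨ (not a ∧ b ∧ c)
      b′ = b ∨ s⁻ ∨ (not b ∧ d ∧ a) in
  ⟦ a′ ⟧ + ⟦ a′ ∧ not b′ ⟧ + ⟦ not b ∧ d ∧ a ⟧
    ≤ ⟦ a ⟧ + ⟦ a ∧ not b ⟧ + ⟦ not a ∧ b ∧ c ⟧ + 2 * ⟦ s ⟧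
local-step = truth-table 6 _ _ _

potential-step : ∀ sh n {B σ B′} → Vanishes n B → Steps sh n B σ B′ →
  potential sh n B′ ≤ potential sh n B + 2 * ∑[ i < n ] ⟦ σ i ⟧
potential-step sh n {B} {σ} {B′} vanish steps = +-cancelʳ-≤ G _ _ (begin
  potential sh n B′ + G                                ≡⟨ cong (_ +_) (∑-prev-hole sh n B vanish) ⟨
  potential sh n B′ + ∑[ i < n ] ⟦ prev sh n g i ⟧     ≡⟨ ∑-distrib-+ n _ _ ⟨
  ∑[ i < n ] (weight sh n B′ i + ⟦ prev sh n g i ⟧)    ≤⟨ ∑-mono-≤ n local ⟩
  ∑[ i < n ] (weight sh n B i + ⟦ g i ⟧ + 2 * ⟦ σ i ⟧) ≡⟨ ∑-distrib-+ n _ _ ⟩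
  ∑[ i < n ] (weight sh n B i + ⟦ g i ⟧) + ∑[ i < n ] (2 * ⟦ σ i ⟧)
                                                       ≡⟨ cong₂ _+_ (∑-distrib-+ n _ _) (∑-*ˡ n 2 _) ⟩
  potential sh n B + G + 2 * S                         ≡⟨ xy∙z≈xz∙y (potential sh n B) G _ ⟩
  potential sh n B + 2 * S + G                         ∎)
  where
  open ≤-Reasoning
  g : State
  g = hole sh n B
  G S : ℕ
  G = ∑[ i < n ] ⟦ g i ⟧
  S = ∑[ i < n ] ⟦ σ i ⟧
  local : ∀ i → i < n →
    weight sh n B′ i + ⟦ prev sh n g i ⟧ ≤ weight sh n B i + ⟦ g i ⟧ + 2 * ⟦ σ i ⟧
  local i i<n rewrite steps i i<n | prev-steps sh n steps i i<n | prev-hole sh n B i<n =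
    local-step (B i) (prev sh n B i) (next sh n B i) (prev sh n (prev sh n B) i) (σ i) (prev sh n σ i)

potential-empty : ∀ sh n {B} → (∀ i → B i ≡ false) → potential sh n B ≤ 0
potential-empty sh n {B} empty =
  ≤-trans (∑-mono-≤ n weightless) (≤-reflexive (trans (∑-const n 0) (*-zeroʳ n)))
  where
  weightless : ∀ i → i < n → weight sh n B i ≤ 0
  weightless i _ rewrite empty i = ≤-refl

full-potential : ∀ sh n {B} → (∀ i → i < n → T (B i)) → n ≤ potential sh n B
full-potential sh n {B} all = n≤∑< n blue-weight
  where
  blue-weight : ∀ i → i < n → 1 ≤ weight sh n B i
  blue-weight i i<n rewrite to T-≡ (all i i<n) = s≤s z≤n

full-potential-path : ∀ m {B} → (∀ i → i < suc m → T (B i)) → 2 + m ≤ potential path (suc m) B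
full-potential-path m {B} all = +-mono-≤ first (n≤∑< m λ i i<m → rest i (s<s i<m))
  where
  first : 2 ≤ weight path (suc m) B 0
  first rewrite to T-≡ (all 0 z<s) = ≤-refl
  rest : ∀ i → suc i < suc m → 1 ≤ weight path (suc m) B (suc i)
  rest i 1+i<n rewrite to T-≡ (all (suc i) 1+i<n) = s≤s z≤n

-- The variables are those of local-step.  The first two summands on the right vanish
-- when vertex i burns in the round and i, i − 1 are not both sources.
local-cover : ∀ a b c d s s⁻ →
  let g  = not a ∧ b ∧ c
      g⁻ = not b ∧ d ∧ a in
  1 + ⟦ g⁻ ⟧ + ⟦ s⁻ ∧ not (b ∨ g⁻) ⟧
    ≤ 2 * ⟦ not (a ∨ s ∨ g) ⟧ + ⟦ s ∧ s⁻ ⟧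
      + (⟦ a ⟧ + ⟦ a ∧ not b ⟧ + ⟦ g ⟧ + ⟦ s ∧ not (a ∨ g) ⟧)
local-cover = truth-table 6 _ _ _

drop-defects : ∀ {m n x y} → m ≤ 2 * ⟦ not x ⟧ + ⟦ y ⟧ + n → x ≡ true → y ≡ false → m ≤ n
drop-defects m≤n refl refl = m≤n

AtMostOne : State → Set
AtMostOne σ = ∀ {i k} → T (σ i) → T (σ k) → i ≡ k

at-most-one-∧ : ∀ {σ} → AtMostOne σ → ∀ {i k} → i ≢ k → σ i ∧ σ k ≡ false
at-most-one-∧ {σ} amo {i} {k} i≢k with σ i in σi | σ k in σk
... | false | _     = refl
... | true  | false = refl
... | true  | true  = ⊥-elim (i≢k (amo (from T-≡ σi) (from T-≡ σk)))

essential : ℕ → State → State → State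
essential n B σ i = σ i ∧ not (B i ∨ hole cycle n B i)

cycle-covered-local : ∀ n {B σ} → 2 ≤ n → AtMostOne σ → Covered cycle n B σ → ∀ i → i < n →
  1 + ⟦ prev cycle n (hole cycle n B) i ⟧ + ⟦ prev cycle n (essential n B σ) i ⟧
    ≤ weight cycle n B i + ⟦ hole cycle n B i ⟧ + ⟦ essential n B σ i ⟧
cycle-covered-local (suc (suc m)) {B} {σ} _ amo covered zero 0<n rewrite ≡ᵇ-refl m = drop-defects
  (local-cover (B 0) (B (suc m)) (B 1) (B m) (σ 0) (σ (suc m)))
  (to T-≡ (covered 0 0<n)) (at-most-one-∧ amo {0} {suc m} λ ())
cycle-covered-local n {B} {σ} _ amo covered (suc i) i<n rewrite ≢⇒≡ᵇ-false (<⇒≢ i<n) = drop-defects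
  (local-cover (B (suc i)) (B i) (next cycle n B (suc i)) (prev cycle n B i) (σ (suc i)) (σ i))
  (to T-≡ (covered (suc i) i<n)) (at-most-one-∧ amo 1+n≢n)
cycle-covered-local (suc zero) (s≤s ())

-- Summed around the cycle, the terms for holes and essential sources at i − 1 and at i cancel.
cycle-covered-potential : ∀ n {B σ} → 2 ≤ n → AtMostOne σ → Covered cycle n B σ →
  n ≤ potential cycle n B
cycle-covered-potential n {B} {σ} 2≤n amo covered = +-cancelʳ-≤ (G + S′) n (potential cycle n B) (begin
  n + (G + S′)
    ≡⟨ cong₂ (λ x y → n + (x + y)) (∑-prev-cycle n g) (∑-prev-cycle n σ′) ⟨
  n + (G⁻ + S′⁻)
    ≡⟨ +-assoc n G⁻ S′⁻ ⟨
  n + G⁻ + S′⁻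
    ≡⟨ cong (λ x → x + G⁻ + S′⁻) (trans (∑-const n 1) (*-identityʳ n)) ⟨
  ∑[ i < n ] 1 + G⁻ + S′⁻
    ≡⟨ cong (_+ S′⁻) (∑-distrib-+ n _ _) ⟨
  ∑[ i < n ] (1 + ⟦ prev cycle n g i ⟧) + S′⁻
    ≡⟨ ∑-distrib-+ n _ _ ⟨
  ∑[ i < n ] (1 + ⟦ prev cycle n g i ⟧ + ⟦ prev cycle n σ′ i ⟧)
    ≤⟨ ∑-mono-≤ n (cycle-covered-local n {B} 2≤n amo covered) ⟩
  ∑[ i < n ] (weight cycle n B i + ⟦ g i ⟧ + ⟦ σ′ i ⟧)
    ≡⟨ ∑-distrib-+ n _ _ ⟩
  ∑[ i < n ] (weight cycle n B i + ⟦ g i ⟧) + S′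
    ≡⟨ cong (_+ S′) (∑-distrib-+ n _ _) ⟩
  potential cycle n B + G + S′
    ≡⟨ +-assoc (potential cycle n B) G S′ ⟩
  potential cycle n B + (G + S′) ∎)
  where
  open ≤-Reasoning
  g σ′ : State
  g  = hole cycle n B
  σ′ = essential n B σ
  G S′ G⁻ S′⁻ : ℕ
  G  = ∑[ i < n ] ⟦ g i ⟧
  S′ = ∑[ i < n ] ⟦ σ′ i ⟧
  G⁻  = ∑[ i < n ] ⟦ prev cycle n g i ⟧
  S′⁻ = ∑[ i < n ] ⟦ prev cycle n σ′ i ⟧

path-hole⇒cycle-hole : ∀ n B → Vanishes n B → ∀ i → T (hole path n B i) → T (hole cycle n B i)
path-hole⇒cycle-hole n B vanish zero    hole₀ = ⊥-elim (proj₂ (to (T-∧ {not (B 0)}) hole₀))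
path-hole⇒cycle-hole n B vanish (suc i) holeᵢ with suc (suc i) ≡ᵇ n in last
... | false = holeᵢ
... | true  = ⊥-elim (subst T (vanish (suc (suc i)) (≤-reflexive (sym (≡ᵇ⇒≡ _ _ (from T-≡ last)))))
                             (T-∧-last (not (B (suc i))) (B i) holeᵢ))

potential-cycle≤path : ∀ n B → potential cycle n B ≤ potential path n B
potential-cycle≤path n B = ∑-mono-≤ n weight≤
  where
  ⟦∧⟧≤⟦∧true⟧ : ∀ x y → ⟦ x ∧ y ⟧ ≤ ⟦ x ∧ true ⟧
  ⟦∧⟧≤⟦∧true⟧ = truth-table 2 _ _ _
  weight≤ : ∀ i → i < n → weight cycle n B i ≤ weight path n B i
  weight≤ zero    _ = +-monoʳ-≤ ⟦ B 0 ⟧ (⟦∧⟧≤⟦∧true⟧ (B 0) _)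
  weight≤ (suc i) _ = ≤-refl

covered-potential : ∀ sh n {B σ} → 2 ≤ n → Vanishes n B → AtMostOne σ → Covered sh n B σ →
  n ≤ potential sh n B
covered-potential cycle n {B} 2≤n _ amo covered = cycle-covered-potential n {B} 2≤n amo covered
-- Holes of the path are holes of the cycle, and the cycle counts no more runs than the path.
covered-potential path n {B} {σ} 2≤n vanish amo covered =
  ≤-trans (cycle-covered-potential n {B} 2≤n amo covered′) (potential-cycle≤path n B)
  where
  covered′ : Covered cycle n B σ
  covered′ i i<n = T-∨-monoʳ (B i) (T-∨-monoʳ (σ i) (path-hole⇒cycle-hole n B vanish i)) (covered i i<n)

-- The 2-burning process on P_n and C_n

blueAt : ∀ {n} → Graph n → List (Fin n) → ℕ → State
blueAt G s j = extend (blue G s j)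

nextSource : ∀ {n} → List (Fin n) → ℕ → State
nextSource s j = extend (isSource s (suc j))

record Neighbours (sh : Shape) (n : ℕ) (G : Graph n) : Set where
  field
    count-blue-neighbours : ∀ (C : Fin n → Bool) v →
      count n (λ u → G v u ∧ C u)
        ≡ ⟦ prev sh n (extend C) (toℕ v) ⟧ + ⟦ next sh n (extend C) (toℕ v) ⟧
open Neighbours

burn-rule : ∀ b s p q → b ∨ s ∨ (2 ≤ᵇ ⟦ p ⟧ + ⟦ q ⟧) ≡ b ∨ s ∨ (not b ∧ p ∧ q)
burn-rule true  s p     q     = refl
burn-rule false s true  true  = refl
burn-rule false s true  false = refl
burn-rule false s false true  = refl
burn-rule false s false false = refl

blue-steps : ∀ {sh n G} → Neighbours sh n G → ∀ s j →
  Steps sh n (blueAt G s j) (nextSource s j) (blueAt G s (suc j))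
blue-steps {sh} {n} {G} neighbours s j i i<n
  rewrite extend-fromℕ< (blue G s (suc j)) i<n | extend-fromℕ< (blue G s j) i<n
        | extend-fromℕ< (isSource s (suc j)) i<n | count-blue-neighbours neighbours (blue G s j) (fromℕ< i<n)
        | toℕ-fromℕ< i<n
  = burn-rule (blue G s j (fromℕ< i<n)) (isSource s (suc j) (fromℕ< i<n))
              (prev sh n (blueAt G s j) i) (next sh n (blueAt G s j) i)

adjacent-to-suc : ∀ t k → (suc (suc t) ≡ᵇ k) ∨ (k ≡ᵇ t) ≡ (k ≡ᵇ t) ∨ (k ≡ᵇ suc (suc t))
adjacent-to-suc t k =
  trans (∨-comm (suc (suc t) ≡ᵇ k) (k ≡ᵇ t)) (cong ((k ≡ᵇ t) ∨_) (≡ᵇ-sym (suc (suc t)) k))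

count-adjacent : ∀ {n} (G : Graph n) (C : Fin n → Bool) v {a b} → a ≢ b →
  (∀ u → G v u ≡ (toℕ u ≡ᵇ a) ∨ (toℕ u ≡ᵇ b)) →
  count n (λ u → G v u ∧ C u) ≡ ⟦ extend C a ⟧ + ⟦ extend C b ⟧
count-adjacent G C v a≢b adjacent =
  trans (count-cong λ u → cong (_∧ C u) (adjacent u)) (count-pair C a≢b)

path-neighbours : ∀ n → Neighbours path n (pathAdj n)
path-neighbours n .count-blue-neighbours C v = at (toℕ v) refl
  where
  at : ∀ t → toℕ v ≡ t →
    count n (λ u → pathAdj n v u ∧ C u)
      ≡ ⟦ prev path n (extend C) t ⟧ + ⟦ next path n (extend C) t ⟧
  at zero    v≡t = trans (count-cong λ u → cong (_∧ C u) (adjacent u)) (count-point 1 C)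
    where
    adjacent : ∀ u → pathAdj n v u ≡ (toℕ u ≡ᵇ 1)
    adjacent u rewrite v≡t = trans (∨-identityʳ _) (≡ᵇ-sym 1 (toℕ u))
  at (suc t) v≡t = count-adjacent (pathAdj n) C v (<⇒≢ (m<n⇒m<1+n (n<1+n t))) adjacent
    where
    adjacent : ∀ u → pathAdj n v u ≡ (toℕ u ≡ᵇ t) ∨ (toℕ u ≡ᵇ suc (suc t))
    adjacent u rewrite v≡t = adjacent-to-suc t (toℕ u)

cycle-neighbours : ∀ {n} → 3 ≤ n → Neighbours cycle n (cycleAdj n)
cycle-neighbours {suc (suc (suc m))} _ .count-blue-neighbours C v = at (toℕ v) refl
  where
  n : ℕ
  n = 3 + m
  at : ∀ t → toℕ v ≡ t →
    count n (λ u → cycleAdj n v u ∧ C u)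
      ≡ ⟦ prev cycle n (extend C) t ⟧ + ⟦ next cycle n (extend C) t ⟧
  at zero v≡t = count-adjacent (cycleAdj n) C v (λ ()) adjacent
    where
    adjacent : ∀ u → cycleAdj n v u ≡ (toℕ u ≡ᵇ suc (suc m)) ∨ (toℕ u ≡ᵇ 1)
    adjacent u rewrite v≡t with toℕ u
    ... | zero        = refl
    ... | suc zero    = refl
    ... | suc (suc k) = refl
  at (suc t) v≡t with t ≟ suc m
  ... | yes refl rewrite ≡ᵇ-refl m = count-adjacent (cycleAdj n) C v (λ ()) adjacent
    where
    adjacent : ∀ u → cycleAdj n v u ≡ (toℕ u ≡ᵇ suc m) ∨ (toℕ u ≡ᵇ 0)
    adjacent u rewrite v≡t | ≡ᵇ-refl m | ≢⇒≡ᵇ-false (≢-sym (<⇒≢ (toℕ<n u))) =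
      cong ((toℕ u ≡ᵇ suc m) ∨_) (∧-identityʳ _)
  ... | no t≢1+m rewrite ≢⇒≡ᵇ-false t≢1+m =
    count-adjacent (cycleAdj n) C v (<⇒≢ (m<n⇒m<1+n (n<1+n t))) adjacent
    where
    adjacent : ∀ u → cycleAdj n v u ≡ (toℕ u ≡ᵇ t) ∨ (toℕ u ≡ᵇ suc (suc t))
    adjacent u rewrite v≡t | ≢⇒≡ᵇ-false t≢1+m =
      trans (cong (((suc (suc t) ≡ᵇ toℕ u) ∨ (toℕ u ≡ᵇ t)) ∨_) (∧-zeroʳ (toℕ u ≡ᵇ 0)))
            (trans (∨-identityʳ _) (adjacent-to-suc t (toℕ u)))
cycle-neighbours {suc zero}       (s≤s ())
cycle-neighbours {suc (suc zero)} (s≤s (s≤s ()))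

isSource-unique : ∀ {n} (s : List (Fin n)) j {v w} → T (isSource s j v) → T (isSource s j w) → v ≡ w
isSource-unique (x ∷ s) (suc zero) {v} {w} sv sw with x ≟ᶠ v | x ≟ᶠ w
... | yes refl | yes refl = refl
isSource-unique (x ∷ s) (suc (suc j)) sv  sw  = isSource-unique s (suc j) sv sw

source-at-most-one : ∀ {n} (s : List (Fin n)) j → AtMostOne (nextSource s j)
source-at-most-one s j {i} {k} si sk with extend-witness _ i si | extend-witness _ k sk
... | v , v≡i , sv | w , w≡k , sw =
  trans (sym v≡i) (trans (cong toℕ (isSource-unique s (suc j) sv sw)) w≡k)

count-≟ : ∀ {n} (x : Fin n) → count n (λ v → does (x ≟ᶠ v)) ≡ 1
count-≟ {suc n} Fin.zero    = cong suc (count-false n)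
count-≟ {suc n} (Fin.suc x) = count-≟ x

count-sources : ∀ {n} (s : List (Fin n)) j →
  j ⊓ length s + count n (isSource s (suc j)) ≤ suc j ⊓ length s
count-sources {n} []      j       = ≤-reflexive (cong₂ _+_ (⊓-zeroʳ j) (count-false n))
count-sources     (x ∷ s) zero    = ≤-reflexive (count-≟ x)
count-sources     (x ∷ s) (suc j) = s≤s (count-sources s j)

potential-bound : ∀ {sh n G} → Neighbours sh n G → ∀ s j →
  potential sh n (blueAt G s j) ≤ 2 * (j ⊓ length s)
potential-bound {sh} {n}     neighbours s zero    = potential-empty sh n (extend-false {n})
potential-bound {sh} {n} {G} neighbours s (suc j) = begin
  potential sh n (blueAt G s (suc j))
    ≤⟨ potential-step sh n (extend-vanishes _) (blue-steps neighbours s j) ⟩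
  potential sh n (blueAt G s j) + 2 * ∑[ i < n ] ⟦ nextSource s j i ⟧
    ≡⟨ cong (λ c → potential sh n (blueAt G s j) + 2 * c) (∑-extend (isSource s (suc j))) ⟩
  potential sh n (blueAt G s j) + 2 * count n (isSource s (suc j))
    ≤⟨ +-monoˡ-≤ _ (potential-bound neighbours s j) ⟩
  2 * (j ⊓ length s) + 2 * count n (isSource s (suc j))
    ≡⟨ *-distribˡ-+ 2 (j ⊓ length s) _ ⟨
  2 * (j ⊓ length s + count n (isSource s (suc j)))
    ≤⟨ *-monoʳ-≤ 2 (count-sources s j) ⟩
  2 * (suc j ⊓ length s) ∎
  where open ≤-Reasoning

potential-≤-length : ∀ {sh n G} → Neighbours sh n G → ∀ s r →
  potential sh n (blueAt G s r) ≤ 2 * length s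
potential-≤-length neighbours s r =
  ≤-trans (potential-bound neighbours s r) (*-monoʳ-≤ 2 (m⊓n≤n r (length s)))

allBlue⇒blueAt : ∀ {n} (G : Graph n) s r → AllBlue G s r → ∀ i → i < n → T (blueAt G s r i)
allBlue⇒blueAt G s r all i i<n = from T-≡ (trans (extend-fromℕ< _ i<n) (all (fromℕ< i<n)))

allBlue⇒covered : ∀ {sh n G} → Neighbours sh n G → ∀ {s j} → AllBlue G s (suc j) →
  Covered sh n (blueAt G s j) (nextSource s j)
allBlue⇒covered {G = G} neighbours {s} {j} all i i<n =
  subst T (blue-steps neighbours s j i i<n) (allBlue⇒blueAt G s (suc j) all i i<n)

not-allBlue-initially : ∀ {n} (G : Graph (suc n)) s → ¬ AllBlue G s 0
not-allBlue-initially G s all with all Fin.zero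
... | ()

rounds-lower-bound : ∀ {sh n G} → 2 ≤ n → Neighbours sh n G → ∀ s r → AllBlue G s r →
  suc ⌈ n /2⌉ ≤ r
rounds-lower-bound {G = G} (s≤s _) neighbours s zero all = ⊥-elim (not-allBlue-initially G s all)
rounds-lower-bound {sh} {n} {G} 2≤n neighbours s (suc j) all = n≤2*r⇒⌈n/2⌉≤r (begin
  2 + n
    ≤⟨ +-monoʳ-≤ 2 (covered-potential sh n 2≤n (extend-vanishes _) (source-at-most-one s j)
                     (allBlue⇒covered neighbours {s} {j} all)) ⟩
  2 + potential sh n (blueAt G s j)
    ≤⟨ +-monoʳ-≤ 2 (potential-bound neighbours s j) ⟩
  2 + 2 * (j ⊓ length s)
    ≤⟨ +-monoʳ-≤ 2 (*-monoʳ-≤ 2 (m⊓n≤m j (length s))) ⟩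
  2 + 2 * j
    ≡⟨ *-suc 2 j ⟨
  2 * suc j ∎)
  where open ≤-Reasoning

blueAt-mono : ∀ {sh n G} → Neighbours sh n G → ∀ s {i} → i < n → ∀ {j k} → j ≤ k →
  T (blueAt G s j i) → T (blueAt G s k i)
blueAt-mono neighbours s i<n {k = zero}  z≤n    = id
blueAt-mono neighbours s i<n {k = suc k} j≤1+k with m≤n⇒m<n∨m≡n j≤1+k
... | inj₁ j<1+k =
  steps-keep {B = blueAt _ s k} (blue-steps neighbours s k) i<n ∘ blueAt-mono neighbours s i<n (≤-pred j<1+k)
... | inj₂ refl  = id

-- Burning the even vertices

clamp : ∀ m → ℕ → Fin (suc m)
clamp m i = fromℕ< (s≤s (m⊓n≤n i m))

evenSources : ∀ m → ℕ → List (Fin (suc m))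
evenSources m L = applyUpTo (λ i → clamp m (2 * i)) L

isSource-applyUpTo : ∀ {n} (f : ℕ → Fin n) {L i} → i < L → T (isSource (applyUpTo f L) (suc i) (f i))
isSource-applyUpTo f {suc L} {zero}  _         = from T-≡ (dec-true (f 0 ≟ᶠ f 0) refl)
isSource-applyUpTo f {suc L} {suc i} (s≤s i<L) = isSource-applyUpTo (f ∘ suc) i<L

even-source : ∀ m {L i} → i < L → T (nextSource (evenSources m L) i (2 * i ⊓ m))
even-source m {L} {i} i<L =
  subst (T ∘ nextSource (evenSources m L) i) (toℕ-fromℕ< (s≤s (m⊓n≤n (2 * i) m)))
    (subst T (sym (extend-toℕ (isSource (evenSources m L) (suc i)) (clamp m (2 * i))))
      (isSource-applyUpTo (λ k → clamp m (2 * k)) i<L))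

module _ {sh m G} (neighbours : Neighbours sh (suc m) G) {L} (enough : ⌈ suc m /2⌉ ≤ L) where

  private
    sources : List (Fin (suc m))
    sources = evenSources m L

  source-burns : ∀ {i} → i < L → T (blueAt G sources (suc i) (2 * i ⊓ m))
  source-burns {i} i<L = steps-source {B = blueAt G sources i} (blue-steps neighbours sources i)
    (s≤s (m⊓n≤n (2 * i) m)) (even-source m {L} {i} i<L)

  even-vertex-burns : ∀ {i} → 2 * i ≤ m → T (blueAt G sources (suc i) (2 * i))
  even-vertex-burns {i} 2i≤m = subst (T ∘ blueAt G sources (suc i)) (m≤n⇒m⊓n≡m 2i≤m)
    (source-burns {i} (≤-trans (2*i<n⇒i<⌈n/2⌉ {i} (s≤s 2i≤m)) enough))

  inner-vertices-burn : ∀ t → t < m → T (blueAt G sources (suc ⌈ suc m /2⌉) t)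
  inner-vertices-burn t t<m with parity t
  ... | i , inj₁ refl = blueAt-mono neighbours sources (m<n⇒m<1+n t<m)
    (m≤n⇒m≤1+n (2*i<n⇒i<⌈n/2⌉ {i} (m<n⇒m<1+n t<m))) (even-vertex-burns {i} (<⇒≤ t<m))
  ... | i , inj₂ refl = blueAt-mono neighbours sources (m<n⇒m<1+n t<m)
    (s≤s (2*i<n⇒i<⌈n/2⌉ {suc i} (s≤s 2+2i≤m))) filled
    where
    2+2i≤m : 2 * suc i ≤ m
    2+2i≤m = subst (_≤ m) (sym (*-suc 2 i)) t<m
    left : T (blueAt G sources (2 + i) (2 * i))
    left = blueAt-mono neighbours sources (<-trans (n<1+n (2 * i)) (m<n⇒m<1+n t<m)) (n≤1+n (suc i))
      (even-vertex-burns {i} (<⇒≤ (<-trans (n<1+n (2 * i)) t<m)))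
    right : T (next sh (suc m) (blueAt G sources (2 + i)) (suc (2 * i)))
    right = subst T (sym (trans (next-inner sh (suc m) (blueAt G sources (2 + i)) (s≤s t<m))
                                (cong (blueAt G sources (2 + i)) (sym (*-suc 2 i)))))
                    (even-vertex-burns {suc i} 2+2i≤m)
    filled : T (blueAt G sources (3 + i) (suc (2 * i)))
    filled = steps-fill {B = blueAt G sources (2 + i)} (blue-steps neighbours sources (2 + i))
      (m<n⇒m<1+n t<m) left right

blueAt⇒allBlue : ∀ {m} (G : Graph (suc m)) s r →
  (∀ t → t < m → T (blueAt G s r t)) → T (blueAt G s r m) → AllBlue G s r
blueAt⇒allBlue {m} G s r inner last v = to T-≡ (subst T (extend-toℕ (blue G s r) v) (vertex-burns))
  where
  vertex-burns : T (blueAt G s r (toℕ v))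
  vertex-burns with m≤n⇒m<n∨m≡n (≤-pred (toℕ<n v))
  ... | inj₁ v<m = inner (toℕ v) v<m
  ... | inj₂ v≡m = subst (T ∘ blueAt G s r) (sym v≡m) last

path-burns : ∀ m → AllBlue (pathAdj (suc m)) (evenSources m (suc ⌈ m /2⌉)) (suc ⌈ suc m /2⌉)
path-burns m =
  blueAt⇒allBlue (pathAdj (suc m)) sources (suc ⌈ suc m /2⌉) (inner-vertices-burn neighbours enough) last
  where
  neighbours : Neighbours path (suc m) (pathAdj (suc m))
  neighbours = path-neighbours (suc m)
  sources : List (Fin (suc m))
  sources = evenSources m (suc ⌈ m /2⌉)
  enough : ⌈ suc m /2⌉ ≤ suc ⌈ m /2⌉
  enough = s≤s (⌊n/2⌋≤⌈n/2⌉ m)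
  last : T (blueAt (pathAdj (suc m)) sources (suc ⌈ suc m /2⌉) m)
  last = blueAt-mono neighbours sources ≤-refl (s≤s (⌈n/2⌉-mono (n≤1+n m)))
    (subst (T ∘ blueAt (pathAdj (suc m)) sources (suc ⌈ m /2⌉)) (m≥n⇒m⊓n≡n (n≤2*⌈n/2⌉ m))
      (source-burns neighbours enough {⌈ m /2⌉} ≤-refl))

-- For odd n the last vertex is a source; for even n it lies between the sources 2p and 0.
cycle-last-burns : ∀ m → Neighbours cycle (suc m) (cycleAdj (suc m)) →
  T (blueAt (cycleAdj (suc m)) (evenSources m ⌈ suc m /2⌉) (suc ⌈ suc m /2⌉) m)
cycle-last-burns m neighbours with parity m
... | p , inj₁ refl = blueAt-mono neighbours S (n<1+n (2 * p)) (s≤s (<⇒≤ p<L))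
  (subst (T ∘ blueAt (cycleAdj (suc m)) S (suc p)) (⊓-idem (2 * p)) (source-burns neighbours ≤-refl {p} p<L))
  where
  S : List (Fin (suc m))
  S = evenSources m ⌈ suc m /2⌉
  p<L : p < ⌈ suc m /2⌉
  p<L = 2*i<n⇒i<⌈n/2⌉ {p} (n<1+n (2 * p))
... | p , inj₂ refl = steps-fill {B = blueAt G S L} (blue-steps neighbours S L) (n<1+n m) before after
  where
  G : Graph (suc m)
  G = cycleAdj (suc m)
  L : ℕ
  L = ⌈ suc m /2⌉
  S : List (Fin (suc m))
  S = evenSources m L
  p<L : p < L
  p<L = 2*i<n⇒i<⌈n/2⌉ {p} (m<n⇒m<1+n (n<1+n (2 * p)))
  0<L : 0 < L
  0<L = ≤-<-trans z≤n p<L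
  before : T (blueAt G S L (2 * p))
  before = blueAt-mono neighbours S (m<n⇒m<1+n (n<1+n (2 * p))) p<L
    (even-vertex-burns neighbours ≤-refl {p} (n≤1+n (2 * p)))
  after : T (next cycle (suc m) (blueAt G S L) m)
  after = subst T (sym (next-last m (blueAt G S L)))
    (blueAt-mono neighbours S z<s 0<L (source-burns neighbours ≤-refl {0} 0<L))

cycle-burns : ∀ m → 2 ≤ m →
  AllBlue (cycleAdj (suc m)) (evenSources m ⌈ suc m /2⌉) (suc ⌈ suc m /2⌉)
cycle-burns m 2≤m = blueAt⇒allBlue (cycleAdj (suc m)) (evenSources m ⌈ suc m /2⌉) (suc ⌈ suc m /2⌉)
  (inner-vertices-burn neighbours ≤-refl) (cycle-last-burns m neighbours)
  where
  neighbours : Neighbours cycle (suc m) (cycleAdj (suc m))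
  neighbours = cycle-neighbours (s≤s 2≤m)

t2-from-bounds : ∀ {n} {G : Graph n} {L R} (s : List (Fin n)) → length s ≡ L → AllBlue G s R →
  (∀ s′ r → AllBlue G s′ r → R ≤ r) → (∀ s′ r → AllBlue G s′ r → L ≤ length s′) →
  T2Is G L
t2-from-bounds {R = R} s length≡L burnt rounds≥ length≥ =
  (s , R , ((burnt , λ j j<R burntʲ → <⇒≱ j<R (rounds≥ s j burntʲ))
          , λ s′ r′ hasRound → rounds≥ s′ r′ (proj₁ hasRound)) , length≡L)
  , λ s′ r′ optimal → length≥ s′ r′ (proj₁ (proj₁ optimal))

path-length-bound : ∀ m s r → AllBlue (pathAdj (suc m)) s r → suc ⌈ m /2⌉ ≤ length s
path-length-bound m s r burnt = n≤2*r⇒⌈n/2⌉≤r (≤-trans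
  (full-potential-path m (allBlue⇒blueAt (pathAdj (suc m)) s r burnt))
  (potential-≤-length (path-neighbours (suc m)) s r))

t2-path : ∀ {n} → 1 ≤ n → T2Is (pathAdj n) (suc ⌊ n /2⌋)
-- P_1 burns in round 1, one round before the general bound ⌈n/2⌉ + 1.
t2-path {suc zero} _ = t2-from-bounds (evenSources 0 1) refl burnt rounds≥ (path-length-bound 0)
  where
  burnt : AllBlue (pathAdj 1) (evenSources 0 1) 1
  burnt = blueAt⇒allBlue (pathAdj 1) (evenSources 0 1) 1 (λ _ ())
    (source-burns (path-neighbours 1) ≤-refl {0} z<s)
  rounds≥ : ∀ s r → AllBlue (pathAdj 1) s r → 1 ≤ r
  rounds≥ s zero    burnt = ⊥-elim (not-allBlue-initially (pathAdj 1) s burnt)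
  rounds≥ s (suc r) _     = s≤s z≤n
t2-path {suc (suc m)} _ = t2-from-bounds (evenSources (suc m) (suc ⌈ suc m /2⌉))
  (length-applyUpTo (λ i → clamp (suc m) (2 * i)) _)
  (path-burns (suc m)) (rounds-lower-bound (s≤s (s≤s z≤n)) (path-neighbours (2 + m)))
  (path-length-bound (suc m))

t2-cycle : ∀ {n} → 3 ≤ n → T2Is (cycleAdj n) ⌈ n /2⌉
t2-cycle {suc m} 3≤n@(s≤s 2≤m) = t2-from-bounds (evenSources m ⌈ suc m /2⌉)
  (length-applyUpTo (λ i → clamp m (2 * i)) _)
  (cycle-burns m 2≤m) (rounds-lower-bound (m≤n⇒m≤1+n 2≤m) neighbours) length≥
  where
  neighbours : Neighbours cycle (suc m) (cycleAdj (suc m))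
  neighbours = cycle-neighbours 3≤n
  length≥ : ∀ s r → AllBlue (cycleAdj (suc m)) s r → ⌈ suc m /2⌉ ≤ length s
  length≥ s r burnt = n≤2*r⇒⌈n/2⌉≤r (≤-trans
    (full-potential cycle (suc m) (allBlue⇒blueAt (cycleAdj (suc m)) s r burnt))
    (potential-≤-length neighbours s r))

mainTheorem16 : (n : ℕ) →
    (1 ≤ n → n % 2 ≡ 0 → T2Is (pathAdj n) (⌈ n /2⌉ + 1))
  × (3 ≤ n → n % 2 ≡ 0 → T2Is (cycleAdj n) ⌈ n /2⌉)
  × (1 ≤ n → n % 2 ≡ 1 → T2Is (pathAdj n) ⌈ n /2⌉)
  × (3 ≤ n → n % 2 ≡ 1 → T2Is (cycleAdj n) ⌈ n /2⌉)
mainTheorem16 n =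
    (λ 1≤n even → subst (T2Is (pathAdj n))
                    (trans (cong suc (n%2≡0⇒⌊n/2⌋≡⌈n/2⌉ n even)) (+-comm 1 ⌈ n /2⌉))
                    (t2-path 1≤n))
  , (λ 3≤n _ → t2-cycle 3≤n)
  , (λ 1≤n odd → subst (T2Is (pathAdj n)) (n%2≡1⇒1+⌊n/2⌋≡⌈n/2⌉ n odd) (t2-path 1≤n))
  , (λ 3≤n _ → t2-cycle 3≤n)
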